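{- Let $\pi\in\mathfrak{S}_n$ with $I(\pi)=(c_1,\dots,c_n)$. For any $1\le i\le n-1$ and $1\le s\le n-i$, if $c_i\ge c_{i+1}\ge\cdots\ge c_{i+s}$, then in the permutation $\Psi(\pi)$ the letter $i+s$ is not immediately followed by the letter $i$.
   Context: For $\pi\in\mathfrak{S}_n$, $I(\pi)=(c_1,\dots,c_n)$ where $c_i$ is the number of letters $j<i$ that lie to the right of the letter $i$ in $\pi$. A descent of a permutation $\sigma$ is an index $j$ with $\sigma_j>\sigma_{j+1}$. The bijection $\Psi:\mathfrak{S}_n\to\mathfrak{S}_n$ is defined recursively: $\Psi(1)=1$; for $\pi\in\mathfrak{S}_n$ ($n\ge2$) with $I(\pi)=(c_1,\dots,c_n)$, let $\pi'$ be $\pi$ with the letter $n$ deleted; label the $n$ positions (gaps) of $\Psi(\pi')$: (a) the position after the last letter gets label $0$; (b) the positions immediately following the descents of $\Psi(\pi')$ get labels $1,\dots,\mathrm{des}(\Psi(\pi'))$ from right to left; (c) the remaining positions get labels $\mathrm{des}(\Psi(\pi'))+1,\dots,n-1$ from left to right. Then $\Psi(\pi)$ is obtained by inserting $n$ into the position labeled $c_n$. -}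

module Defs where

open import Data.Nat using (ℕ; zero; suc; _+_; _∸_; _<ᵇ_; _≡ᵇ_)
open import Data.Bool using (Bool; true; false; if_then_else_; not)
open import Data.List using (List; []; _∷_; _++_; map; upTo; take; drop; length; zipWith)
open import Data.Product using (∃₂)
open import Relation.Binary.PropositionalEquality using (_≡_)

-- Permutations of [n] = {1,…,n} are represented in one-line notation as lists of
-- naturals that are permutations (_↭_) of  oneTo n = [1, 2, …, n].
oneTo : ℕ → List ℕ
oneTo n = map suc (upTo n)

count : (ℕ → Bool) → List ℕ → ℕ
count p [] = 0
count p (x ∷ xs) = if p x then suc (count p xs) else count p xs

rightOf : ℕ → List ℕ → List ℕ
rightOf k [] = []
rightOf k (x ∷ xs) = if x ≡ᵇ k then xs else rightOf k xs

code : List ℕ → ℕ → ℕ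
code π k = count (λ j → j <ᵇ k) (rightOf k π)

removeLetter : ℕ → List ℕ → List ℕ
removeLetter k [] = []
removeLetter k (x ∷ xs) = if x ≡ᵇ k then removeLetter k xs else x ∷ removeLetter k xs

-- Gaps of a word σ of length m are numbered 0,…,m (gap g = after the first g letters).
-- Kind of each gap: the final gap, a gap immediately following a descent, or other.
data GapKind : Set where
  lastGap descGap otherGap : GapKind

kindsFrom : ℕ → List ℕ → List GapKind
kindsFrom x [] = lastGap ∷ []
kindsFrom x (y ∷ ys) = (if y <ᵇ x then descGap else otherGap) ∷ kindsFrom y ys

gapKinds : List ℕ → List GapKind
gapKinds [] = lastGap ∷ []
gapKinds (x ∷ xs) = otherGap ∷ kindsFrom x xs

isDesc : GapKind → Bool
isDesc descGap = true
isDesc _ = false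

isOther : GapKind → Bool
isOther otherGap = true
isOther _ = false

countK : (GapKind → Bool) → List GapKind → ℕ
countK p [] = 0
countK p (x ∷ xs) = if p x then suc (countK p xs) else countK p xs

des : List ℕ → ℕ
des σ = countK isDesc (gapKinds σ)

-- label of gap g of σ:
--  final gap ↦ 0; descent gaps ↦ 1,…,des from right to left;
--  remaining gaps ↦ des+1,…,|σ| from left to right.
gapLabel : List ℕ → ℕ → ℕ
gapLabel σ g with gapKinds σ
... | ks = lab (drop g ks)
  where
  lab : List GapKind → ℕ
  lab [] = 0
  lab (lastGap ∷ _) = 0
  lab (descGap ∷ rest) = suc (countK isDesc rest)
  lab (otherGap ∷ _) = suc (des σ + countK isOther (take g ks))

gapWithLabel : ℕ → List ℕ → ℕ
gapWithLabel c σ = go 0 (suc (length σ))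
  where
  go : ℕ → ℕ → ℕ
  go g zero = g
  go g (suc fuel) = if gapLabel σ g ≡ᵇ c then g else go (suc g) fuel

insertAt : ℕ → ℕ → List ℕ → List ℕ
insertAt g a σ = take g σ ++ a ∷ drop g σ

Psi : ℕ → List ℕ → List ℕ
Psi zero π = []
Psi (suc n) π = insertAt (gapWithLabel (code π (suc n)) σ) (suc n) σ
  where
  σ : List ℕ
  σ = Psi n (removeLetter (suc n) π)

ImmFollowed : ℕ → ℕ → List ℕ → Set
ImmFollowed a b w = ∃₂ λ l r → w ≡ l ++ a ∷ b ∷ r

module Submission where

-- Write C = c_i.  Ψ(π) inserts the letters 1, 2, …, n in turn, letter k into the gap labelled c_k.
-- Inserting a new largest letter never lowers the label of the gap in front of an old letter x
-- unless it lands in that very gap (the numbers of descents, of descent gaps to the right and of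
-- other gaps to the left can only grow), and the gap in front of the new letter gets a larger label
-- than the gap it was put into.  So from the moment i is inserted (into the gap labelled C) the
-- gap in front of i carries a label > C, and this persists while i+1, …, i+s are inserted: each
-- of them goes into a gap labelled c_k ≤ C, hence never directly in front of i.  In particular
-- i+s is not put directly in front of i, and inserting larger letters keeps them apart.

open import Defs
open import Data.Bool using (Bool; true; false; if_then_else_; T)
open import Data.Empty using (⊥-elim)
open import Data.List using (List; []; _∷_; _++_; take; drop; length; applyUpTo)
open import Data.List.Properties using (++-assoc; ∷-injectiveˡ; ∷-injectiveʳ; take++drop≡id; length-take; take-all; drop-all; map-upTo)
open import Data.List.Relation.Binary.Permutation.Propositional as ↭ using (_↭_)
open import Data.List.Relation.Unary.All as All using (All; []; _∷_)
open import Data.List.Relation.Unary.All.Properties using (++⁺; ++⁻ˡ; ++⁻ʳ; take⁺; drop⁺)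
open import Data.Maybe using (Maybe; just; nothing)
import Data.Maybe.Relation.Unary.All as Maybe
open import Data.Nat using (ℕ; zero; suc; _+_; _∸_; _≤_; _<_; _≤′_; ≤′-refl; ≤′-step; _<ᵇ_; _≡ᵇ_; z≤n; s≤s; _≟_; _≤?_)
open import Data.Nat.Properties
open import Data.Product using (_×_; _,_)
open import Data.Sum using (_⊎_; inj₁; inj₂)
open import Relation.Binary.PropositionalEquality using (_≡_; _≢_; refl; sym; trans; cong; cong₂; subst; subst₂; module ≡-Reasoning)
open import Relation.Nullary using (¬_; yes; no)
open import Relation.Nullary.Reflects using (ofʸ; ofⁿ)
open import Function using (_∘_)

search : (ℕ → Bool) → ℕ → ℕ → ℕ
search found g zero = g
search found g (suc fuel) = if found g then g else search found (suc g) fuel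

search-unique : ∀ found (h : ℕ → ℕ → ℕ) → (∀ g → h g 0 ≡ g) →
                (∀ g fuel → h g (suc fuel) ≡ (if found g then g else h (suc g) fuel)) →
                ∀ g fuel → h g fuel ≡ search found g fuel
search-unique found h h-zero h-suc g zero = h-zero g
search-unique found h h-zero h-suc g (suc fuel) rewrite h-suc g fuel with found g
... | true = refl
... | false = search-unique found h h-zero h-suc (suc g) fuel

-- The local loop of gapWithLabel cannot be named.  Abstracting length σ and the literal 1
-- leaves it applied to variables, so unification solves the function h of search-unique with it.
gapWithLabel≡search : ∀ c σ → gapWithLabel c σ ≡ search (λ g → gapLabel σ g ≡ᵇ c) 0 (suc (length σ))
gapWithLabel≡search c σ with length σ | 1 | search-unique (λ g → gapLabel σ g ≡ᵇ c) _ (λ _ → refl) (λ _ _ → refl)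
... | len | one | go≡search = cong (λ g → if gapLabel σ 0 ≡ᵇ c then 0 else g) (go≡search one len)

search-spec : ∀ found g fuel → T (found (search found g fuel)) ⊎ search found g fuel ≡ g + fuel
search-spec found g zero = inj₂ (sym (+-identityʳ g))
search-spec found g (suc fuel) with found g in found-g
... | true = inj₁ (subst T (sym found-g) _)
... | false with search-spec found (suc g) fuel
...   | inj₁ hit = inj₁ hit
...   | inj₂ miss = inj₂ (trans miss (sym (+-suc g fuel)))

gapWithLabel-spec : ∀ c σ → gapLabel σ (gapWithLabel c σ) ≡ c ⊎ gapWithLabel c σ ≡ suc (length σ)
gapWithLabel-spec c σ rewrite gapWithLabel≡search c σ
  with search-spec (λ g → gapLabel σ g ≡ᵇ c) 0 (suc (length σ))
... | inj₁ hit = inj₁ (≡ᵇ⇒≡ _ c hit)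
... | inj₂ miss = inj₂ miss

-- p : Maybe ℕ is the letter preceding the word, if any.
kindBefore : Maybe ℕ → ℕ → GapKind
kindBefore nothing y = otherGap
kindBefore (just x) y = if y <ᵇ x then descGap else otherGap

gapKindsAfter : Maybe ℕ → List ℕ → List GapKind
gapKindsAfter p [] = lastGap ∷ []
gapKindsAfter p (y ∷ ys) = kindBefore p y ∷ gapKindsAfter (just y) ys

letterGapKinds : Maybe ℕ → List ℕ → List GapKind
letterGapKinds p [] = []
letterGapKinds p (y ∷ ys) = kindBefore p y ∷ letterGapKinds (just y) ys

lastLetter : Maybe ℕ → List ℕ → Maybe ℕ
lastLetter p [] = p
lastLetter p (y ∷ ys) = lastLetter (just y) ys

kindsFrom≡gapKindsAfter : ∀ x ys → kindsFrom x ys ≡ gapKindsAfter (just x) ys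
kindsFrom≡gapKindsAfter x [] = refl
kindsFrom≡gapKindsAfter x (y ∷ ys) = cong (_ ∷_) (kindsFrom≡gapKindsAfter y ys)

gapKinds≡gapKindsAfter : ∀ σ → gapKinds σ ≡ gapKindsAfter nothing σ
gapKinds≡gapKindsAfter [] = refl
gapKinds≡gapKindsAfter (x ∷ xs) = cong (_ ∷_) (kindsFrom≡gapKindsAfter x xs)

gapKindsAfter-++ : ∀ p u w → gapKindsAfter p (u ++ w) ≡ letterGapKinds p u ++ gapKindsAfter (lastLetter p u) w
gapKindsAfter-++ p [] w = refl
gapKindsAfter-++ p (y ∷ u) w = cong (_ ∷_) (gapKindsAfter-++ (just y) u w)

length-letterGapKinds : ∀ p u → length (letterGapKinds p u) ≡ length u
length-letterGapKinds p [] = refl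
length-letterGapKinds p (y ∷ u) = cong suc (length-letterGapKinds (just y) u)

lastLetter-++-∷ : ∀ p u a w → lastLetter p (u ++ a ∷ w) ≡ lastLetter (just a) w
lastLetter-++-∷ p [] a w = refl
lastLetter-++-∷ p (y ∷ u) a w = lastLetter-++-∷ (just y) u a w

lastLetter-below : ∀ {k} p u → Maybe.All (_< k) p → All (_< k) u → Maybe.All (_< k) (lastLetter p u)
lastLetter-below p [] p<k [] = p<k
lastLetter-below p (y ∷ u) p<k (y<k ∷ u<k) = lastLetter-below (just y) u (Maybe.just y<k) u<k

kindBefore-≢lastGap : ∀ p y → kindBefore p y ≢ lastGap
kindBefore-≢lastGap nothing y ()
kindBefore-≢lastGap (just x) y eq with y <ᵇ x
kindBefore-≢lastGap (just x) y () | true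
kindBefore-≢lastGap (just x) y () | false

kindBefore-max : ∀ {k} p → Maybe.All (_< k) p → kindBefore p k ≡ otherGap
kindBefore-max nothing _ = refl
kindBefore-max {k} (just x) (Maybe.just x<k) with k <ᵇ x | <ᵇ-reflects-< k x
... | true | ofʸ k<x = ⊥-elim (<-asym x<k k<x)
... | false | ofⁿ _ = refl

kindBefore-afterMax : ∀ {k y} → y < k → kindBefore (just k) y ≡ descGap
kindBefore-afterMax {k} {y} y<k with y <ᵇ k | <ᵇ-reflects-< y k
... | true | ofʸ _ = refl
... | false | ofⁿ y≮k = ⊥-elim (y≮k y<k)

countK-++ : ∀ P X Y → countK P (X ++ Y) ≡ countK P X + countK P Y
countK-++ P [] Y = refl
countK-++ P (κ ∷ X) Y with P κ
... | true = cong suc (countK-++ P X Y)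
... | false = countK-++ P X Y

countK-∷-≤ : ∀ P κ X → countK P (κ ∷ X) ≤ suc (countK P X)
countK-∷-≤ P κ X with P κ
... | true = ≤-refl
... | false = n≤1+n _

countK-∷-mono : ∀ P κ X Y → countK P X ≤ countK P Y → countK P (κ ∷ X) ≤ countK P (κ ∷ Y)
countK-∷-mono P κ X Y X≤Y with P κ
... | true = s≤s X≤Y
... | false = X≤Y

countDesc-gapKindsAfter : ∀ p w → countK isDesc (gapKindsAfter p w) ≡ countK isDesc (letterGapKinds p w)
countDesc-gapKindsAfter p [] = refl
countDesc-gapKindsAfter p (y ∷ w) with isDesc (kindBefore p y)
... | true = cong suc (countDesc-gapKindsAfter (just y) w)
... | false = countDesc-gapKindsAfter (just y) w

des≡countDesc-letterGapKinds : ∀ σ → des σ ≡ countK isDesc (letterGapKinds nothing σ)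
des≡countDesc-letterGapKinds σ = trans (cong (countK isDesc) (gapKinds≡gapKindsAfter σ)) (countDesc-gapKindsAfter nothing σ)

des-++ : ∀ u w → des (u ++ w) ≡ countK isDesc (letterGapKinds nothing u) + countK isDesc (gapKindsAfter (lastLetter nothing u) w)
des-++ u w = begin
  des (u ++ w)                                   ≡⟨ cong (countK isDesc) (gapKinds≡gapKindsAfter (u ++ w)) ⟩
  countK isDesc (gapKindsAfter nothing (u ++ w)) ≡⟨ cong (countK isDesc) (gapKindsAfter-++ nothing u w) ⟩
  countK isDesc (letterGapKinds nothing u ++ _)  ≡⟨ countK-++ isDesc (letterGapKinds nothing u) _ ⟩
  _                                              ∎
  where open ≡-Reasoning

countDesc+countOther : ∀ p u → countK isDesc (letterGapKinds p u) + countK isOther (letterGapKinds p u) ≡ length u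
countDesc+countOther p [] = refl
countDesc+countOther p (y ∷ u) with kindBefore p y in κ≡
... | lastGap = ⊥-elim (kindBefore-≢lastGap p y κ≡)
... | descGap = cong suc (countDesc+countOther (just y) u)
... | otherGap = trans (+-suc _ _) (cong suc (countDesc+countOther (just y) u))

-- A new largest letter k replaces the kind κ of the gap in front of its right neighbour y
-- by otherGap (in front of k) and descGap (between k and y); P counts one of these two kinds.
countK-letterGapKinds-insertMax : ∀ P → (∀ R → suc (countK P R) ≤ countK P (otherGap ∷ descGap ∷ R)) →
  ∀ {k} p u w → Maybe.All (_< k) p → All (_< k) u → All (_< k) w →
  countK P (letterGapKinds p (u ++ w)) ≤ countK P (letterGapKinds p (u ++ k ∷ w))
countK-letterGapKinds-insertMax P grows p [] [] p<k [] [] = z≤n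
countK-letterGapKinds-insertMax P grows p [] (y ∷ w) p<k [] (y<k ∷ _)
  rewrite kindBefore-max p p<k | kindBefore-afterMax y<k =
  ≤-trans (countK-∷-≤ P (kindBefore p y) (letterGapKinds (just y) w)) (grows (letterGapKinds (just y) w))
countK-letterGapKinds-insertMax P grows {k} p (a ∷ u) w p<k (a<k ∷ u<k) w<k =
  countK-∷-mono P (kindBefore p a) (letterGapKinds (just a) (u ++ w)) (letterGapKinds (just a) (u ++ k ∷ w))
    (countK-letterGapKinds-insertMax P grows (just a) u w (Maybe.just a<k) u<k w<k)

des-insertMax : ∀ {k} u w → All (_< k) u → All (_< k) w → des (u ++ w) ≤ des (u ++ k ∷ w)
des-insertMax {k} u w u<k w<k = subst₂ _≤_ (sym (des≡countDesc-letterGapKinds (u ++ w))) (sym (des≡countDesc-letterGapKinds (u ++ k ∷ w)))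
  (countK-letterGapKinds-insertMax isDesc (λ _ → ≤-refl) nothing u w Maybe.nothing u<k w<k)

labelFromKinds : ℕ → List GapKind → GapKind → List GapKind → ℕ
labelFromKinds d before lastGap after = 0
labelFromKinds d before descGap after = suc (countK isDesc after)
labelFromKinds d before otherGap after = suc (d + countK isOther before)

labelFromKinds-mono : ∀ κ {d d′ before before′ after after′} → d ≤ d′ →
  countK isOther before ≤ countK isOther before′ → countK isDesc after ≤ countK isDesc after′ →
  labelFromKinds d before κ after ≤ labelFromKinds d′ before′ κ after′
labelFromKinds-mono lastGap _ _ _ = z≤n
labelFromKinds-mono descGap _ _ after≤ = s≤s after≤
labelFromKinds-mono otherGap d≤ before≤ _ = s≤s (+-mono-≤ d≤ before≤)

drop-length-++ : ∀ {A : Set} (xs ys : List A) → drop (length xs) (xs ++ ys) ≡ ys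
drop-length-++ [] ys = refl
drop-length-++ (x ∷ xs) ys = drop-length-++ xs ys

take-length-++ : ∀ {A : Set} (xs ys : List A) → take (length xs) (xs ++ ys) ≡ xs
take-length-++ [] ys = refl
take-length-++ (x ∷ xs) ys = cong (x ∷_) (take-length-++ xs ys)

gapKinds-++ : ∀ u w {κ after} → gapKindsAfter (lastLetter nothing u) w ≡ κ ∷ after →
  gapKinds (u ++ w) ≡ letterGapKinds nothing u ++ κ ∷ after
gapKinds-++ u w kinds-w =
  trans (gapKinds≡gapKindsAfter (u ++ w)) (trans (gapKindsAfter-++ nothing u w) (cong (letterGapKinds nothing u ++_) kinds-w))

drop-gapKinds : ∀ u w {κ after} → gapKindsAfter (lastLetter nothing u) w ≡ κ ∷ after →
  drop (length u) (gapKinds (u ++ w)) ≡ κ ∷ after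
drop-gapKinds u w kinds-w =
  trans (cong₂ drop (sym (length-letterGapKinds nothing u)) (gapKinds-++ u w kinds-w)) (drop-length-++ (letterGapKinds nothing u) _)

take-gapKinds : ∀ u w {κ after} → gapKindsAfter (lastLetter nothing u) w ≡ κ ∷ after →
  take (length u) (gapKinds (u ++ w)) ≡ letterGapKinds nothing u
take-gapKinds u w kinds-w =
  trans (cong₂ take (sym (length-letterGapKinds nothing u)) (gapKinds-++ u w kinds-w)) (take-length-++ (letterGapKinds nothing u) _)

gapLabel-split : ∀ u w {κ after} → gapKindsAfter (lastLetter nothing u) w ≡ κ ∷ after →
  gapLabel (u ++ w) (length u) ≡ labelFromKinds (des (u ++ w)) (letterGapKinds nothing u) κ after
gapLabel-split u w {lastGap} kinds-w rewrite drop-gapKinds u w kinds-w = refl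
gapLabel-split u w {descGap} kinds-w rewrite drop-gapKinds u w kinds-w = refl
gapLabel-split u w {otherGap} kinds-w rewrite drop-gapKinds u w kinds-w | take-gapKinds u w kinds-w = refl

gapLabel-before : ∀ u x r → gapLabel (u ++ x ∷ r) (length u) ≡
  labelFromKinds (des (u ++ x ∷ r)) (letterGapKinds nothing u) (kindBefore (lastLetter nothing u) x) (gapKindsAfter (just x) r)
gapLabel-before u x r = gapLabel-split u (x ∷ r) refl

gapLabel-insertMax-left : ∀ {k} u a w x r → All (_< k) (u ++ a ∷ w ++ x ∷ r) →
  gapLabel (u ++ a ∷ w ++ x ∷ r) (length (u ++ a ∷ w)) ≤ gapLabel (u ++ k ∷ a ∷ w ++ x ∷ r) (length (u ++ k ∷ a ∷ w))
gapLabel-insertMax-left {k} u a w x r σ<k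
  rewrite sym (++-assoc u (a ∷ w) (x ∷ r)) | sym (++-assoc u (k ∷ a ∷ w) (x ∷ r))
        | gapLabel-before (u ++ a ∷ w) x r | gapLabel-before (u ++ k ∷ a ∷ w) x r
        | lastLetter-++-∷ nothing u a w | lastLetter-++-∷ nothing u k (a ∷ w) =
  labelFromKinds-mono (kindBefore (lastLetter (just a) w) x) des≤
    (countK-letterGapKinds-insertMax isOther (λ _ → ≤-refl) nothing u (a ∷ w) Maybe.nothing u<k aw<k)
    ≤-refl
  where
  uaw<k = ++⁻ˡ (u ++ a ∷ w) σ<k
  u<k = ++⁻ˡ u uaw<k
  aw<k = ++⁻ʳ u uaw<k
  des≤ : des ((u ++ a ∷ w) ++ x ∷ r) ≤ des ((u ++ k ∷ a ∷ w) ++ x ∷ r)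
  des≤ = subst₂ (λ σ τ → des σ ≤ des τ) (sym (++-assoc u (a ∷ w) (x ∷ r))) (sym (++-assoc u (k ∷ a ∷ w) (x ∷ r)))
    (des-insertMax u (a ∷ w ++ x ∷ r) u<k (++⁺ aw<k (++⁻ʳ (u ++ a ∷ w) σ<k)))

gapLabel-insertMax-right : ∀ {k} u x v w → All (_< k) ((u ++ x ∷ v) ++ w) →
  gapLabel ((u ++ x ∷ v) ++ w) (length u) ≤ gapLabel ((u ++ x ∷ v) ++ k ∷ w) (length u)
gapLabel-insertMax-right {k} u x v w σ<k
  rewrite ++-assoc u (x ∷ v) w | ++-assoc u (x ∷ v) (k ∷ w)
        | gapLabel-before u x (v ++ w) | gapLabel-before u x (v ++ k ∷ w) =
  labelFromKinds-mono (kindBefore (lastLetter nothing u) x) des≤ ≤-refl after≤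
  where
  xvw<k = ++⁻ʳ u σ<k
  w<k = ++⁻ʳ v (All.tail xvw<k)
  des≤ : des (u ++ x ∷ v ++ w) ≤ des (u ++ x ∷ v ++ k ∷ w)
  des≤ = subst₂ (λ σ τ → des σ ≤ des τ) (++-assoc u (x ∷ v) w) (++-assoc u (x ∷ v) (k ∷ w))
    (des-insertMax (u ++ x ∷ v) w (++⁺ (++⁻ˡ u σ<k) (All.head xvw<k ∷ ++⁻ˡ v (All.tail xvw<k))) w<k)
  after≤ : countK isDesc (gapKindsAfter (just x) (v ++ w)) ≤ countK isDesc (gapKindsAfter (just x) (v ++ k ∷ w))
  after≤ = subst₂ _≤_ (sym (countDesc-gapKindsAfter (just x) (v ++ w))) (sym (countDesc-gapKindsAfter (just x) (v ++ k ∷ w)))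
    (countK-letterGapKinds-insertMax isDesc (λ _ → ≤-refl) (just x) v w
      (Maybe.just (All.head xvw<k)) (++⁻ˡ v (All.tail xvw<k)) w<k)

gapLabel-beforeMax : ∀ {k} u w → All (_< k) u →
  gapLabel (u ++ k ∷ w) (length u) ≡ suc (des (u ++ k ∷ w) + countK isOther (letterGapKinds nothing u))
gapLabel-beforeMax {k} u w u<k
  rewrite gapLabel-before u k w | kindBefore-max (lastLetter nothing u) (lastLetter-below nothing u Maybe.nothing u<k) = refl

des-beforeMax-∷ : ∀ {k} u y ys → All (_< k) u → y < k →
  des (u ++ k ∷ y ∷ ys) ≡ countK isDesc (letterGapKinds nothing u) + suc (countK isDesc (gapKindsAfter (just y) ys))
des-beforeMax-∷ {k} u y ys u<k y<k
  rewrite des-++ u (k ∷ y ∷ ys) | kindBefore-max (lastLetter nothing u) (lastLetter-below nothing u Maybe.nothing u<k)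
        | kindBefore-afterMax y<k = refl

gapLabel-insertMax-here : ∀ {k} u w → All (_< k) u → All (_< k) w →
  gapLabel (u ++ w) (length u) < gapLabel (u ++ k ∷ w) (length u)
gapLabel-insertMax-here u [] u<k [] rewrite gapLabel-beforeMax u [] u<k | gapLabel-split u [] {lastGap} {[]} refl = s≤s z≤n
gapLabel-insertMax-here {k} u (y ∷ ys) u<k (y<k ∷ _)
  rewrite gapLabel-beforeMax u (y ∷ ys) u<k | gapLabel-before u y ys | des-beforeMax-∷ u y ys u<k y<k
  with kindBefore (lastLetter nothing u) y in κ≡
... | lastGap = s≤s z≤n
... | descGap = s≤s (≤-trans (m≤n+m _ descs) (m≤m+n _ _))
  where descs = countK isDesc (letterGapKinds nothing u)
... | otherGap = s≤s (+-monoˡ-< _ des<)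
  where
  des< : des (u ++ y ∷ ys) < countK isDesc (letterGapKinds nothing u) + suc (countK isDesc (gapKindsAfter (just y) ys))
  des< rewrite des-++ u (y ∷ ys) | κ≡ | +-suc (countK isDesc (letterGapKinds nothing u)) (countK isDesc (gapKindsAfter (just y) ys)) = ≤-refl

gapLabel-appendMax : ∀ {k} u → All (_< k) u → length u < gapLabel (u ++ k ∷ []) (length u)
gapLabel-appendMax {k} u u<k rewrite gapLabel-beforeMax u [] u<k = s≤s (begin
  length u                                                    ≡⟨ sym (countDesc+countOther nothing u) ⟩
  countK isDesc (letterGapKinds nothing u) + others           ≤⟨ +-monoˡ-≤ others descs≤des ⟩
  des (u ++ k ∷ []) + others                                  ∎)
  where
  open ≤-Reasoning
  others = countK isOther (letterGapKinds nothing u)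
  descs≤des : countK isDesc (letterGapKinds nothing u) ≤ des (u ++ k ∷ [])
  descs≤des = subst (_ ≤_) (sym (des-++ u (k ∷ []))) (m≤m+n _ _)

data Split {A : Set} (u : List A) (k : A) (w l : List A) (x : A) (r : List A) : Set where
  same : u ≡ l → k ≡ x → w ≡ r → Split u k w l x r
  xAfter : ∀ v → l ≡ u ++ k ∷ v → w ≡ v ++ x ∷ r → Split u k w l x r
  xBefore : ∀ v → u ≡ l ++ x ∷ v → r ≡ v ++ k ∷ w → Split u k w l x r

split : ∀ {A : Set} u (k : A) w l x r → u ++ k ∷ w ≡ l ++ x ∷ r → Split u k w l x r
split [] k w [] x r eq = same refl (∷-injectiveˡ eq) (∷-injectiveʳ eq)
split [] k w (y ∷ l) x r eq rewrite ∷-injectiveˡ eq = xAfter l refl (∷-injectiveʳ eq)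
split (a ∷ u) k w [] x r eq rewrite ∷-injectiveˡ eq = xBefore u refl (sym (∷-injectiveʳ eq))
split (a ∷ u) k w (b ∷ l) x r eq with ∷-injectiveˡ eq | split u k w l x r (∷-injectiveʳ eq)
... | refl | same u≡l k≡x w≡r = same (cong (a ∷_) u≡l) k≡x w≡r
... | refl | xAfter v l≡ w≡ = xAfter v (cong (a ∷_) l≡) w≡
... | refl | xBefore v u≡ r≡ = xBefore v (cong (a ∷_) u≡) r≡

¬All<-self : ∀ {k} u w → ¬ All (_< k) (u ++ k ∷ w)
¬All<-self u w σ<k = <-irrefl refl (All.head (++⁻ʳ u σ<k))

ImmFollowed-removeMax : ∀ {k a b} u w → a < k → b < k → ImmFollowed a b (u ++ k ∷ w) → ImmFollowed a b (u ++ w)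
ImmFollowed-removeMax {k} {a} {b} u w a<k b<k (l , r , eq) with split u k w l a (b ∷ r) eq
... | same _ refl _ = ⊥-elim (<-irrefl refl a<k)
... | xAfter v refl refl = u ++ v , r , sym (++-assoc u v (a ∷ b ∷ r))
... | xBefore [] refl r≡ = ⊥-elim (<-irrefl (∷-injectiveˡ r≡) b<k)
... | xBefore (y ∷ v) refl r≡ rewrite ∷-injectiveˡ r≡ | ∷-injectiveʳ r≡ = l , v ++ w , ++-assoc l (a ∷ y ∷ v) w

-- The gap u|w of σ = u ++ w where Ψ inserts the new largest letter: it carries label c,
-- unless no gap of σ does, in which case gapWithLabel points past the end and the letter is appended.
InsertionGap : ℕ → List ℕ → List ℕ → Set
InsertionGap c u w = gapLabel (u ++ w) (length u) ≡ c ⊎ (w ≡ [] × c ≤ length u)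

insertionGap-gapWithLabel : ∀ c σ → c ≤ length σ → InsertionGap c (take (gapWithLabel c σ) σ) (drop (gapWithLabel c σ) σ)
insertionGap-gapWithLabel c σ c≤ with gapWithLabel c σ | gapWithLabel-spec c σ
... | g | found with g ≤? length σ
...   | no g≰ rewrite take-all g σ (<⇒≤ (≰⇒> g≰)) | drop-all g σ (<⇒≤ (≰⇒> g≰)) = inj₂ (refl , c≤)
...   | yes g≤ rewrite take++drop≡id g σ | length-take g σ | m≤n⇒m⊓n≡m g≤ with found
...     | inj₁ label≡c = inj₁ label≡c
...     | inj₂ refl = ⊥-elim (<-irrefl refl (≤-<-trans g≤ (n<1+n _)))

record Insertion (k c : ℕ) (σ τ : List ℕ) : Set where
  field
    before after : List ℕ
    σ≡ : σ ≡ before ++ after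
    τ≡ : τ ≡ before ++ k ∷ after
    letters< : All (_< k) σ
    gap : InsertionGap c before after

LabelBefore> : ℕ → ℕ → List ℕ → Set
LabelBefore> C x σ = ∀ l r → σ ≡ l ++ x ∷ r → C < gapLabel σ (length l)

¬insertionGap-before : ∀ {c C x} u r → InsertionGap c u (x ∷ r) → c ≤ C → ¬ LabelBefore> C x (u ++ x ∷ r)
¬insertionGap-before u r (inj₁ label≡c) c≤C above =
  <-irrefl refl (≤-trans (above u r refl) (≤-trans (≤-reflexive label≡c) c≤C))
¬insertionGap-before u r (inj₂ (() , _))

labelBefore>-inserted : ∀ {k c σ τ} → Insertion k c σ τ → LabelBefore> c k τ
labelBefore>-inserted record { before = u ; after = w ; σ≡ = refl ; τ≡ = refl ; letters< = σ<k ; gap = gap } l r eq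
  with split u _ w l _ r eq
... | same refl _ _ = label> gap
  where
  u<k = ++⁻ˡ u σ<k
  label> : ∀ {c} → InsertionGap c u w → c < gapLabel (u ++ _ ∷ w) (length u)
  label> (inj₁ refl) = gapLabel-insertMax-here u w u<k (++⁻ʳ u σ<k)
  label> (inj₂ (refl , c≤)) = ≤-<-trans c≤ (gapLabel-appendMax u u<k)
... | xAfter v _ refl = ⊥-elim (¬All<-self v r (++⁻ʳ u σ<k))
... | xBefore v refl _ = ⊥-elim (¬All<-self l v (++⁻ˡ (l ++ _ ∷ v) σ<k))

labelBefore>-insert : ∀ {k c σ τ C x} → Insertion k c σ τ → x < k → c ≤ C → LabelBefore> C x σ → LabelBefore> C x τ
labelBefore>-insert record { before = u ; after = w ; σ≡ = refl ; τ≡ = refl ; letters< = σ<k ; gap = gap } x<k c≤C above l r eq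
  with split u _ w l _ r eq
... | same _ refl _ = ⊥-elim (<-irrefl refl x<k)
... | xAfter [] refl refl = ⊥-elim (¬insertionGap-before u r gap c≤C above)
... | xAfter (a ∷ v) refl refl =
  <-≤-trans (above (u ++ a ∷ v) r (sym (++-assoc u (a ∷ v) (_ ∷ r)))) (gapLabel-insertMax-left u a v _ r σ<k)
... | xBefore v refl refl =
  <-≤-trans (above l (v ++ w) (++-assoc l (_ ∷ v) w)) (gapLabel-insertMax-right l _ v w σ<k)

¬ImmFollowed-inserted : ∀ {k c σ τ C x} → Insertion k c σ τ → c ≤ C → LabelBefore> C x σ → ¬ ImmFollowed k x τ
¬ImmFollowed-inserted record { before = u ; after = w ; σ≡ = refl ; τ≡ = refl ; letters< = σ<k ; gap = gap } c≤C above (l , r , eq)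
  with split u _ w l _ (_ ∷ r) eq
... | same refl _ refl = ¬insertionGap-before u r gap c≤C above
... | xAfter v _ refl = ¬All<-self v (_ ∷ r) (++⁻ʳ u σ<k)
... | xBefore v refl _ = ¬All<-self l v (++⁻ˡ (l ++ _ ∷ v) σ<k)

≡ᵇ-true⇒≡ : ∀ x m → (x ≡ᵇ m) ≡ true → x ≡ m
≡ᵇ-true⇒≡ x m e = ≡ᵇ⇒≡ x m (subst T (sym e) _)

rightOf-removeLetter : ∀ {k m} xs → k ≢ m → rightOf k (removeLetter m xs) ≡ removeLetter m (rightOf k xs)
rightOf-removeLetter [] k≢m = refl
rightOf-removeLetter {k} {m} (x ∷ xs) k≢m with x ≡ᵇ m in x≡m | x ≡ᵇ k in x≡k
... | true | true = ⊥-elim (k≢m (trans (sym (≡ᵇ-true⇒≡ x k x≡k)) (≡ᵇ-true⇒≡ x m x≡m)))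
... | true | false = rightOf-removeLetter xs k≢m
... | false | true rewrite x≡k = refl
... | false | false rewrite x≡k = rightOf-removeLetter xs k≢m

count-<ᵇ-removeLetter : ∀ {k m} xs → k ≤ m → count (_<ᵇ k) (removeLetter m xs) ≡ count (_<ᵇ k) xs
count-<ᵇ-removeLetter [] k≤m = refl
count-<ᵇ-removeLetter {k} {m} (x ∷ xs) k≤m with x ≡ᵇ m in x≡m
... | true with x <ᵇ k | <ᵇ-reflects-< x k
...   | true | ofʸ x<k = ⊥-elim (<⇒≱ x<k (subst (k ≤_) (sym (≡ᵇ-true⇒≡ x m x≡m)) k≤m))
...   | false | ofⁿ _ = count-<ᵇ-removeLetter xs k≤m
count-<ᵇ-removeLetter {k} (x ∷ xs) k≤m | false with x <ᵇ k
...   | true = cong suc (count-<ᵇ-removeLetter xs k≤m)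
...   | false = count-<ᵇ-removeLetter xs k≤m

code-removeLetter : ∀ {k m} ρ → k < m → code (removeLetter m ρ) k ≡ code ρ k
code-removeLetter ρ k<m rewrite rightOf-removeLetter ρ (<⇒≢ k<m) = count-<ᵇ-removeLetter (rightOf _ ρ) (<⇒≤ k<m)

count-rightOf : ∀ p k xs → count p (rightOf k xs) ≤ count p xs
count-rightOf p k [] = z≤n
count-rightOf p k (x ∷ xs) with x ≡ᵇ k | p x
... | true | true = n≤1+n _
... | true | false = ≤-refl
... | false | true = m≤n⇒m≤1+n (count-rightOf p k xs)
... | false | false = count-rightOf p k xs

count-↭ : ∀ p {xs ys} → xs ↭ ys → count p xs ≡ count p ys
count-↭ p ↭.refl = refl
count-↭ p (↭.prep x xs↭ys) with p x
... | true = cong suc (count-↭ p xs↭ys)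
... | false = count-↭ p xs↭ys
count-↭ p (↭.swap x y xs↭ys) with p x | p y
... | true | true = cong (λ n → suc (suc n)) (count-↭ p xs↭ys)
... | true | false = cong suc (count-↭ p xs↭ys)
... | false | true = cong suc (count-↭ p xs↭ys)
... | false | false = count-↭ p xs↭ys
count-↭ p (↭.trans xs↭ys ys↭zs) = trans (count-↭ p xs↭ys) (count-↭ p ys↭zs)

count-<ᵇ-applyUpTo : ∀ k a f n → (∀ j → a + j ≤ f j) → count (_<ᵇ k) (applyUpTo f n) ≤ k ∸ a
count-<ᵇ-applyUpTo k a f zero f≥ = z≤n
count-<ᵇ-applyUpTo k a f (suc n) f≥
  with count-<ᵇ-applyUpTo k (suc a) (f ∘ suc) n (λ j → subst (_≤ f (suc j)) (+-suc a j) (f≥ (suc j)))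
... | rest≤ with f 0 <ᵇ k | <ᵇ-reflects-< (f 0) k
...   | true | ofʸ f0<k = ≤-trans (s≤s rest≤) (≤-reflexive (sym (+-∸-assoc 1 a<k)))
  where
  a<k : a < k
  a<k = ≤-<-trans (subst (_≤ f 0) (+-identityʳ a) (f≥ 0)) f0<k
...   | false | ofⁿ _ = ≤-trans rest≤ (∸-monoʳ-≤ k (n≤1+n a))

code-≤ : ∀ {n π} k → π ↭ oneTo n → code π k ≤ k ∸ 1
code-≤ {n} {π} k π↭ = begin
  code π k                                  ≤⟨ count-rightOf (_<ᵇ k) k π ⟩
  count (_<ᵇ k) π                           ≡⟨ count-↭ (_<ᵇ k) π↭ ⟩
  count (_<ᵇ k) (oneTo n)                   ≡⟨ cong (count (_<ᵇ k)) (map-upTo suc n) ⟩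
  count (_<ᵇ k) (applyUpTo suc n)           ≤⟨ count-<ᵇ-applyUpTo k 1 suc n (λ _ → ≤-refl) ⟩
  k ∸ 1                                     ∎
  where open ≤-Reasoning

length-insertAt : ∀ g (a : ℕ) σ → length (insertAt g a σ) ≡ suc (length σ)
length-insertAt zero a σ = refl
length-insertAt (suc g) a [] = refl
length-insertAt (suc g) a (x ∷ σ) = cong suc (length-insertAt g a σ)

length-Psi : ∀ m ρ → length (Psi m ρ) ≡ m
length-Psi zero ρ = refl
length-Psi (suc m) ρ = trans (length-insertAt (gapWithLabel (code ρ (suc m)) σ) (suc m) σ) (cong suc (length-Psi m (removeLetter (suc m) ρ)))
  where σ = Psi m (removeLetter (suc m) ρ)

Psi-letters< : ∀ m ρ → All (_< suc m) (Psi m ρ)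
Psi-letters< zero ρ = []
Psi-letters< (suc m) ρ = ++⁺ (take⁺ g σ<) (≤-refl ∷ drop⁺ g σ<)
  where
  g = gapWithLabel (code ρ (suc m)) (Psi m (removeLetter (suc m) ρ))
  σ< = All.map m<n⇒m<1+n (Psi-letters< m (removeLetter (suc m) ρ))

Psi-insertion : ∀ m ρ → code ρ (suc m) ≤ m → Insertion (suc m) (code ρ (suc m)) (Psi m (removeLetter (suc m) ρ)) (Psi (suc m) ρ)
Psi-insertion m ρ c≤m = record
  { before = take g σ
  ; after = drop g σ
  ; σ≡ = sym (take++drop≡id g σ)
  ; τ≡ = refl
  ; letters< = Psi-letters< m (removeLetter (suc m) ρ)
  ; gap = insertionGap-gapWithLabel c σ (subst (c ≤_) (sym (length-Psi m (removeLetter (suc m) ρ))) c≤m)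
  }
  where
  σ = Psi m (removeLetter (suc m) ρ)
  c = code ρ (suc m)
  g = gapWithLabel c σ

ImmFollowed-uninsert : ∀ {k c σ τ a b} → Insertion k c σ τ → a < k → b < k → ImmFollowed a b τ → ImmFollowed a b σ
ImmFollowed-uninsert record { before = u ; after = w ; σ≡ = refl ; τ≡ = refl } = ImmFollowed-removeMax u w

antitone-≤ : ∀ (f : ℕ → ℕ) {i j} → (∀ k → i ≤ k → k < j → f (suc k) ≤ f k) → ∀ {k} → i ≤ k → k ≤ j → f k ≤ f i
antitone-≤ f {i} step i≤k k≤j = go (≤⇒≤′ i≤k) k≤j
  where
  go : ∀ {k} → i ≤′ k → k ≤ _ → f k ≤ f i
  go ≤′-refl _ = ≤-refl
  go {suc k} (≤′-step i≤′k) k<j = ≤-trans (step k (≤′⇒≤ i≤′k) k<j) (go i≤′k (<⇒≤ k<j))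

module _ {n π} (π↭ : π ↭ oneTo n) {i j} (bounded : ∀ k → i < k → k ≤ j → code π k ≤ code π i) where

  Agree : ℕ → List ℕ → Set
  Agree m ρ = ∀ k → k ≤ m → code ρ k ≡ code π k

  agree-removeLetter : ∀ m ρ → Agree (suc m) ρ → Agree m (removeLetter (suc m) ρ)
  agree-removeLetter m ρ agree k k≤m = trans (code-removeLetter ρ (s≤s k≤m)) (agree k (m≤n⇒m≤1+n k≤m))

  agree-insertion : ∀ m ρ → Agree (suc m) ρ → Insertion (suc m) (code ρ (suc m)) (Psi m (removeLetter (suc m) ρ)) (Psi (suc m) ρ)
  agree-insertion m ρ agree = Psi-insertion m ρ (subst (_≤ m) (sym (agree (suc m) ≤-refl)) (code-≤ (suc m) π↭))

  labelBefore>-Psi : ∀ m ρ → i ≤ m → m ≤ j → Agree m ρ → LabelBefore> (code π i) i (Psi m ρ)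
  labelBefore>-Psi zero ρ _ _ _ [] r ()
  labelBefore>-Psi zero ρ _ _ _ (_ ∷ _) r ()
  labelBefore>-Psi (suc m) ρ i≤1+m 1+m≤j agree with i ≟ suc m
  ... | yes refl = subst (λ c → LabelBefore> c i (Psi i ρ)) (agree i ≤-refl) (labelBefore>-inserted (agree-insertion m ρ agree))
  ... | no i≢1+m = labelBefore>-insert (agree-insertion m ρ agree) (s≤s i≤m) c≤cᵢ
                     (labelBefore>-Psi m _ i≤m (<⇒≤ 1+m≤j) (agree-removeLetter m ρ agree))
    where
    i≤m = ≤-pred (≤∧≢⇒< i≤1+m i≢1+m)
    c≤cᵢ = subst (_≤ code π i) (sym (agree (suc m) ≤-refl)) (bounded (suc m) (s≤s i≤m) 1+m≤j)

  ¬ImmFollowed-Psi : i < j → ∀ m ρ → j ≤ m → Agree m ρ → ¬ ImmFollowed j i (Psi m ρ)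
  ¬ImmFollowed-Psi i<j zero ρ j≤0 _ = ⊥-elim (n≮0 (<-≤-trans i<j j≤0))
  ¬ImmFollowed-Psi i<j (suc m) ρ j≤1+m agree with j ≟ suc m
  ... | yes refl = ¬ImmFollowed-inserted (agree-insertion m ρ agree) c≤cᵢ
                     (labelBefore>-Psi m _ (≤-pred i<j) (n≤1+n m) (agree-removeLetter m ρ agree))
    where c≤cᵢ = subst (_≤ code π i) (sym (agree j ≤-refl)) (bounded j i<j ≤-refl)
  ... | no j≢1+m = ¬ImmFollowed-Psi i<j m _ (≤-pred j<1+m) (agree-removeLetter m ρ agree)
                   ∘ ImmFollowed-uninsert (agree-insertion m ρ agree) j<1+m (<-trans i<j j<1+m)
    where j<1+m = ≤∧≢⇒< j≤1+m j≢1+m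

lemma6p5 : (n : ℕ) (π : List ℕ) → π ↭ oneTo n →
           (i s : ℕ) → 1 ≤ i → i ≤ n ∸ 1 → 1 ≤ s → s ≤ n ∸ i →
           (∀ k → i ≤ k → k < i + s → code π (suc k) ≤ code π k) →
           ¬ ImmFollowed (i + s) i (Psi n π)
lemma6p5 n π π↭ i s _ i≤n∸1 1≤s s≤n∸i antitone =
  ¬ImmFollowed-Psi π↭ bounded (m<m+n i 1≤s) n π i+s≤n (λ _ _ → refl)
  where
  bounded : ∀ k → i < k → k ≤ i + s → code π k ≤ code π i
  bounded k i<k k≤i+s = antitone-≤ (code π) antitone (<⇒≤ i<k) k≤i+s
  i+s≤n : i + s ≤ n
  i+s≤n = ≤-trans (+-monoʳ-≤ i s≤n∸i) (≤-reflexive (m+[n∸m]≡n (≤-trans i≤n∸1 (m∸n≤m n 1))))
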